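{- Let $D$ be a bipartite tournament (an orientation of a complete bipartite graph $K_{m,n}$ with $m,n\ge 1$). Then the $(1,2)$-step competition graph $C_{1,2}(D)$ either has at most one non-trivial connected component, or consists of exactly two connected components, each of which is a complete graph on at least three vertices.
   Context: For vertices $x,y$ of a digraph $H$, $d_H(x,y)$ denotes the number of arcs in a shortest directed path from $x$ to $y$ in $H$ (if one exists). The $(1,2)$-step competition graph $C_{1,2}(D)$ of a digraph $D$ is the simple graph with vertex set $V(D)$ in which distinct $u,v$ are adjacent if and only if there is a vertex $w\neq u,v$ such that either $d_{D-v}(u,w)\le 1$ and $d_{D-u}(v,w)\le 2$, or $d_{D-u}(v,w)\le 1$ and $d_{D-v}(u,w)\le 2$. A component is non-trivial if it has at least two vertices. -}

module Defs where

open import Data.Nat using (ℕ)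
open import Data.Fin using (Fin)
open import Data.Bool using (Bool; true; false)
open import Data.Sum using (_⊎_; inj₁; inj₂)
open import Data.Product using (Σ; ∃; ∃-syntax; _×_; _,_)
open import Data.Empty using (⊥)
open import Relation.Binary.PropositionalEquality using (_≡_; _≢_)
open import Relation.Binary.Construct.Closure.ReflexiveTransitive using (Star)

-- A bipartite tournament on parts X = Fin m and Y = Fin n is an orientation
-- of K_{m,n}: for every x ∈ X and y ∈ Y exactly one of the arcs x→y, y→x
-- is present.  We encode it by  o x y = true  iff the arc is x → y
-- (and  o x y = false  iff the arc is y → x).
BipartiteTournament : ℕ → ℕ → Set
BipartiteTournament m n = Fin m → Fin n → Bool

Vertex : ℕ → ℕ → Set
Vertex m n = Fin m ⊎ Fin n

data Arc {m n : ℕ} (o : BipartiteTournament m n) : Vertex m n → Vertex m n → Set where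
  xy : ∀ {x y} → o x y ≡ true  → Arc o (inj₁ x) (inj₂ y)
  yx : ∀ {x y} → o x y ≡ false → Arc o (inj₂ y) (inj₁ x)

-- d_{D - r}(a , b) ≤ 1  for a ≢ b  (a , b ≠ r): an arc a → b.
-- (D has no loops, so a distance-0 case only arises when a = b, which is
--  excluded where this is used.)
Dist≤1 : ∀ {m n} → BipartiteTournament m n → (r a b : Vertex m n) → Set
Dist≤1 o r a b = Arc o a b

-- d_{D - r}(a , b) ≤ 2  for a ≢ b  (a , b ≠ r): an arc a → b, or a
-- directed path a → z → b whose middle vertex z is not the removed vertex r.
Dist≤2 : ∀ {m n} → BipartiteTournament m n → (r a b : Vertex m n) → Set
Dist≤2 o r a b = Arc o a b ⊎ (∃[ z ] (z ≢ r × Arc o a z × Arc o z b))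

C12Adj : ∀ {m n} → BipartiteTournament m n → Vertex m n → Vertex m n → Set
C12Adj o u v =
  u ≢ v ×
  (∃[ w ] (w ≢ u × w ≢ v ×
     ((Dist≤1 o v u w × Dist≤2 o u v w) ⊎ (Dist≤1 o u v w × Dist≤2 o v u w))))

Connected : ∀ {m n} → BipartiteTournament m n → Vertex m n → Vertex m n → Set
Connected o = Star (C12Adj o)

NonTrivialAt : ∀ {m n} → BipartiteTournament m n → Vertex m n → Set
NonTrivialAt o v = ∃[ u ] (u ≢ v × Connected o v u)

AtMostOneNonTrivial : ∀ {m n} → BipartiteTournament m n → Set
AtMostOneNonTrivial o =
  ∀ u v → NonTrivialAt o u → NonTrivialAt o v → Connected o u v

CompleteComponentAtLeast3 : ∀ {m n} → BipartiteTournament m n → Vertex m n → Set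
CompleteComponentAtLeast3 o a =
  (∀ x y → Connected o a x → Connected o a y → x ≢ y → C12Adj o x y) ×
  (∃[ x ] ∃[ y ] ∃[ z ]
     (Connected o a x × Connected o a y × Connected o a z ×
      x ≢ y × y ≢ z × x ≢ z))

TwoCompleteComponents : ∀ {m n} → BipartiteTournament m n → Set
TwoCompleteComponents o =
  ∃[ a ] ∃[ b ]
    ((¬C o a b) ×
     (∀ v → Connected o a v ⊎ Connected o b v) ×
     CompleteComponentAtLeast3 o a ×
     CompleteComponentAtLeast3 o b)
  where
    ¬C : ∀ {m n} → BipartiteTournament m n → Vertex m n → Vertex m n → Set
    ¬C o a b = Connected o a b → ⊥

-- Every edge uv of C_{1,2}(D) is witnessed by a vertex w with two distinct
-- in-neighbours (a common prey), and every vertex reaching w in at most two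
-- steps is joined to the in-neighbours of w. So each non-trivial component
-- contains the in-neighbours of some common prey, and it suffices to connect
-- the in-neighbours of any two common prey w, w'. If w and w' lie in different
-- parts, one of them reaches the other. If they lie in the same part, either a
-- predator of one is a predator of the other, or a third vertex of that part or
-- a common neighbour of w and w' links them. The only way this fails is when that
-- part is {p, q}, every vertex of the other part is an out-neighbour of
-- exactly one of p, q, and both have two out-neighbours; then C_{1,2}(D) is
-- the disjoint union of the cliques {p} ∪ N⁺(p) and {q} ∪ N⁺(q).
module Submission where

open import Defs
open import Data.Nat using (ℕ; _≥_)
open import Data.Fin using (Fin)
open import Data.Fin.Properties using (any?; all?) renaming (_≟_ to _≟ᶠ_)
open import Data.Bool using (Bool; true; false; not)
open import Data.Bool.Properties using (not-injective; ¬-not) renaming (_≟_ to _≟ᵇ_)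
open import Data.Sum using (_⊎_; inj₁; inj₂; swap)
open import Data.Sum.Properties using (≡-dec; inj₁-injective; inj₂-injective; swap-involutive)
import Data.Sum as Sum
import Data.Product as Product
open import Data.Product using (∃-syntax; _×_; _,_; proj₁; proj₂)
open import Data.Empty using (⊥; ⊥-elim)
open import Function using (_∘_)
open import Relation.Nullary using (Dec; yes; no; ¬_)
open import Relation.Nullary.Decidable using (_×-dec_; _⊎-dec_; ¬?)
open import Relation.Binary.PropositionalEquality
open import Relation.Binary.Construct.Closure.ReflexiveTransitive
  using (ε; _◅_; _◅◅_; gmap; reverse)

true≢false : ∀ {b : Bool} → b ≡ true → b ≡ false → ⊥
true≢false refl ()

module InTournament {m n : ℕ} (o : BipartiteTournament m n) where

  V : Set
  V = Vertex m n

  Conn : V → V → Set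
  Conn = Connected o

  _≟ᵛ_ : (u v : V) → Dec (u ≡ v)
  _≟ᵛ_ = ≡-dec _≟ᶠ_ _≟ᶠ_

  arc-irrefl : ∀ {u v} → Arc o u v → u ≢ v
  arc-irrefl (xy _) ()
  arc-irrefl (yx _) ()

  arc-asym : ∀ {u v} → Arc o u v → Arc o v u → ⊥
  arc-asym (xy e) (yx e′) = true≢false e e′
  arc-asym (yx e) (xy e′) = true≢false e′ e

  no-transitive-triangle : ∀ {u z w} → Arc o u z → Arc o z w → Arc o u w → ⊥
  no-transitive-triangle (xy _) (yx _) ()
  no-transitive-triangle (yx _) (xy _) ()

  tournament : (x : Fin m) (y : Fin n) → Arc o (inj₁ x) (inj₂ y) ⊎ Arc o (inj₂ y) (inj₁ x)
  tournament x y with o x y in e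
  ... | true  = inj₁ (xy e)
  ... | false = inj₂ (yx e)

  adj-commonPrey : ∀ {u v w} → Arc o u w → Arc o v w → u ≢ v → C12Adj o u v
  adj-commonPrey uw vw u≢v =
    u≢v , _ , ≢-sym (arc-irrefl uw) , ≢-sym (arc-irrefl vw) , inj₁ (uw , inj₁ vw)

  adj-path : ∀ {u v z w} → Arc o u z → Arc o z w → Arc o v w → v ≢ z → C12Adj o u v
  adj-path uz zw vw v≢z =
    (λ { refl → no-transitive-triangle uz zw vw }) , _ ,
    (λ { refl → arc-asym uz zw }) , ≢-sym (arc-irrefl vw) ,
    inj₂ (vw , inj₂ (_ , ≢-sym v≢z , uz , zw))

  adj-sym : ∀ {u v} → C12Adj o u v → C12Adj o v u
  adj-sym (u≢v , w , w≢u , w≢v , witness) = ≢-sym u≢v , w , w≢v , w≢u , swap witness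

  conn-sym : ∀ {u v} → Conn u v → Conn v u
  conn-sym = reverse adj-sym

  CommonPrey : V → V → V → Set
  CommonPrey w a b = Arc o a w × Arc o b w × a ≢ b

  Reaches≤2 : V → V → Set
  Reaches≤2 v w = Arc o v w ⊎ ∃[ z ] (Arc o v z × Arc o z w)

  reaches-conn-predator : ∀ {w a b v} → CommonPrey w a b → Reaches≤2 v w → Conn v a
  reaches-conn-predator {a = a} {v = v} (aw , bw , a≢b) (inj₁ vw) with v ≟ᵛ a
  ... | yes refl = ε
  ... | no v≢a   = adj-commonPrey vw aw v≢a ◅ ε
  reaches-conn-predator {a = a} (aw , bw , a≢b) (inj₂ (z , vz , zw)) with a ≟ᵛ z
  ... | no a≢z   = adj-path vz zw aw a≢z ◅ ε
  ... | yes refl = adj-path vz zw bw (≢-sym a≢b) ◅ adj-commonPrey bw aw (≢-sym a≢b) ◅ ε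

  commonReach-conn : ∀ {w a b w′ a′ b′ t} → CommonPrey w a b → CommonPrey w′ a′ b′ →
                     Reaches≤2 t w → Reaches≤2 t w′ → Conn a a′
  commonReach-conn g g′ tw tw′ =
    conn-sym (reaches-conn-predator g tw) ◅◅ reaches-conn-predator g′ tw′

  adjacentPrey-conn : ∀ {w a b w′ a′ b′} → Arc o w w′ →
                      CommonPrey w a b → CommonPrey w′ a′ b′ → Conn a a′
  adjacentPrey-conn ww′ g g′ =
    commonReach-conn g g′ (inj₁ (proj₁ g)) (inj₂ (_ , proj₁ g , ww′))

  adj⇒commonPrey : ∀ {u v} → C12Adj o u v →
                   ∃[ w ] ∃[ a ] ∃[ b ] (CommonPrey w a b × Reaches≤2 u w)
  adj⇒commonPrey (u≢v , w , _ , _ , inj₁ (uw , inj₁ vw)) =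
    w , _ , _ , (uw , vw , u≢v) , inj₁ uw
  adj⇒commonPrey (_ , w , _ , _ , inj₁ (uw , inj₂ (_ , z≢u , _ , zw))) =
    w , _ , _ , (uw , zw , ≢-sym z≢u) , inj₁ uw
  adj⇒commonPrey (u≢v , w , _ , _ , inj₂ (vw , inj₁ uw)) =
    w , _ , _ , (vw , uw , ≢-sym u≢v) , inj₁ uw
  adj⇒commonPrey (_ , w , _ , _ , inj₂ (vw , inj₂ (z , z≢v , uz , zw))) =
    w , _ , _ , (vw , zw , ≢-sym z≢v) , inj₂ (z , uz , zw)

  nonTrivial⇒commonPrey : ∀ {u} → NonTrivialAt o u →
                          ∃[ w ] ∃[ a ] ∃[ b ] (CommonPrey w a b × Reaches≤2 u w)
  nonTrivial⇒commonPrey (_ , u′≢u , ε)     = ⊥-elim (u′≢u refl)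
  nonTrivial⇒commonPrey (_ , _ , adj ◅ _) = adj⇒commonPrey adj

  OutPair : Fin m → Set
  OutPair x = ∃[ a ] ∃[ b ] (a ≢ b × o x a ≡ true × o x b ≡ true)

  -- The exceptional configuration: the first part is {p, q}, and p and q have
  -- neither a common out-neighbour nor a common in-neighbour.
  Split : Set
  Split = ∃[ p ] ∃[ q ] (p ≢ q × (∀ x → x ≡ p ⊎ x ≡ q) × (∀ y → o p y ≢ o q y) ×
                         OutPair p × OutPair q)

  split? : Dec Split
  split? = any? λ p → any? λ q →
    ¬? (p ≟ᶠ q) ×-dec all? (λ x → (x ≟ᶠ p) ⊎-dec (x ≟ᶠ q)) ×-dec
    all? (λ y → ¬? (o p y ≟ᵇ o q y)) ×-dec outPair? p ×-dec outPair? q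
    where
    outPair? : ∀ x → Dec (OutPair x)
    outPair? x = any? λ a → any? λ b →
      ¬? (a ≟ᶠ b) ×-dec (o x a ≟ᵇ true) ×-dec (o x b ≟ᵇ true)

  data Unseparated (p q : Fin m) : Set where
    third : ∀ x → x ≢ p → x ≢ q → Unseparated p q
    agree : ∀ y → o p y ≡ o q y → Unseparated p q

  unseparated : ¬ Split → ∀ {p q} → p ≢ q → OutPair p → OutPair q → Unseparated p q
  unseparated ¬split {p} {q} p≢q out-p out-q
    with any? (λ x → ¬? (x ≟ᶠ p) ×-dec ¬? (x ≟ᶠ q))
  ... | yes (x , x≢p , x≢q) = third x x≢p x≢q
  ... | no noThird with any? (λ y → o p y ≟ᵇ o q y)
  ... | yes (y , e) = agree y e
  ... | no noAgree  =
    ⊥-elim (¬split (p , q , p≢q , cover , (λ y e → noAgree (y , e)) , out-p , out-q))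
    where
    cover : ∀ x → x ≡ p ⊎ x ≡ q
    cover x with x ≟ᶠ p | x ≟ᶠ q
    ... | yes x≡p | _       = inj₁ x≡p
    ... | no _    | yes x≡q = inj₂ x≡q
    ... | no x≢p  | no x≢q  = ⊥-elim (noThird (x , x≢p , x≢q))

  crossedPrey-conn : ∀ {p q a b a′ b′} → p ≢ q → Arc o (inj₁ q) a → Arc o (inj₁ p) a′ →
                     CommonPrey (inj₁ p) a b → CommonPrey (inj₁ q) a′ b′ →
                     Unseparated p q → Conn a a′
  crossedPrey-conn {p} {q} p≢q qa pa′ g g′ (agree y e) with tournament p y
  ... | inj₁ py@(xy e-py) =
        conn-sym (reaches-conn-predator g (inj₂ (_ , qa , proj₁ g))) ◅◅
        adj-commonPrey (xy (trans (sym e) e-py)) py (λ q≡p → p≢q (sym (inj₁-injective q≡p))) ◅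
        reaches-conn-predator g′ (inj₂ (_ , pa′ , proj₁ g′))
  ... | inj₂ yp@(yx e-yp) = commonReach-conn g g′ (inj₁ yp) (inj₁ (yx (trans (sym e) e-yp)))
  crossedPrey-conn p≢q qa@(xy {y = α} _) pa′@(xy {y = α′} _) g@(ap , _) g′@(a′q , _)
                   (third x x≢p x≢q) with tournament x α | tournament x α′
  ... | inj₁ xa | inj₁ xa′ = commonReach-conn g g′ (inj₂ (_ , xa , ap)) (inj₂ (_ , xa′ , a′q))
  ... | inj₁ xa | inj₂ a′x =
        commonReach-conn g prey-a (inj₂ (_ , qa , ap)) (inj₁ qa) ◅◅
        commonReach-conn prey-a g′ (inj₂ (_ , a′x , xa)) (inj₁ a′q)
    where prey-a : CommonPrey _ (inj₁ x) (inj₁ _)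
          prey-a = xa , qa , λ x≡q → x≢q (inj₁-injective x≡q)
  ... | inj₂ ax | inj₁ xa′ =
        commonReach-conn g prey-a′ (inj₁ ap) (inj₂ (_ , ax , xa′)) ◅◅
        commonReach-conn prey-a′ g′ (inj₁ pa′) (inj₂ (_ , pa′ , a′q))
    where prey-a′ : CommonPrey _ (inj₁ x) (inj₁ _)
          prey-a′ = xa′ , pa′ , λ x≡p → x≢p (inj₁-injective x≡p)
  ... | inj₂ ax | inj₂ a′x =
        commonReach-conn g prey-x (inj₁ ap) (inj₁ ax) ◅◅
        commonReach-conn prey-x g′ (inj₁ a′x) (inj₁ a′q)
    where prey-x : CommonPrey (inj₁ x) _ _
          prey-x = ax , a′x , λ { refl → arc-asym qa a′q }

  samePart-conn : ¬ Split → ∀ {p q a b a′ b′} →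
                  CommonPrey (inj₁ p) a b → CommonPrey (inj₁ q) a′ b′ → Conn a a′
  samePart-conn ¬split {p} {q} g g′ with p ≟ᶠ q
  ... | yes refl = commonReach-conn g g′ (inj₁ (proj₁ g)) (inj₁ (proj₁ g))
  samePart-conn ¬split {p} {q}
    g@(yx {y = α} _ , yx {y = β} _ , a≢b) g′@(yx {y = α′} _ , yx {y = β′} _ , a′≢b′)
    | no p≢q with tournament q α | tournament q β | tournament p α′ | tournament p β′
  ... | inj₂ aq | _ | _ | _ = commonReach-conn g g′ (inj₁ (proj₁ g)) (inj₁ aq)
  ... | inj₁ _ | inj₂ bq | _ | _ = commonReach-conn g g′ (inj₁ (proj₁ (proj₂ g))) (inj₁ bq)
  ... | inj₁ _ | inj₁ _ | inj₂ a′p | _ =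
        commonReach-conn g g′ (inj₁ a′p) (inj₁ (proj₁ g′))
  ... | inj₁ _ | inj₁ _ | inj₁ _ | inj₂ b′p =
        commonReach-conn g g′ (inj₁ b′p) (inj₁ (proj₁ (proj₂ g′)))
  -- Otherwise each prey beats both predators of the other, so both have two out-neighbours.
  ... | inj₁ qa@(xy e-qα) | inj₁ (xy e-qβ) | inj₁ pa′@(xy e-pα′) | inj₁ (xy e-pβ′) =
        crossedPrey-conn p≢q qa pa′ g g′ (unseparated ¬split p≢q
          (α′ , β′ , (λ e → a′≢b′ (cong inj₂ e)) , e-pα′ , e-pβ′)
          (α , β , (λ e → a≢b (cong inj₂ e)) , e-qα , e-qβ))

module Halves {m n : ℕ} (o : BipartiteTournament m n) {p q : Fin m} (p≢q : p ≢ q)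
  (cover : ∀ x → x ≡ p ⊎ x ≡ q) (disagree : ∀ y → o p y ≢ o q y)
  {a b : Fin n} (a≢b : a ≢ b) (e-a : o p a ≡ true) (e-b : o p b ≡ true)
  where
  open InTournament o

  q-loses : ∀ {y} → o p y ≡ true → o q y ≡ false
  q-loses {y} e = trans (¬-not (≢-sym (disagree y))) (cong not e)

  p-wins : ∀ {y} → o q y ≡ false → o p y ≡ true
  p-wins {y} e = trans (¬-not (disagree y)) (cong not e)

  -- The vertex set of the component of p, namely {p} ∪ N⁺(p).
  InHalf : V → Set
  InHalf (inj₁ x) = x ≡ p
  InHalf (inj₂ y) = o p y ≡ true

  half-commonPrey : ∀ {u v w} → Arc o u w → Arc o v w → InHalf u → InHalf v
  half-commonPrey (xy e) (xy {x′} e′) refl with cover x′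
  ... | inj₁ x′≡p = x′≡p
  ... | inj₂ refl = ⊥-elim (disagree _ (trans e (sym e′)))
  half-commonPrey (yx {x} e) (yx e′) y∈half with cover x
  ... | inj₁ refl = ⊥-elim (true≢false y∈half e)
  ... | inj₂ refl = p-wins e′

  half-path : ∀ {u v z w} → Arc o u w → Arc o v z → Arc o z w → z ≢ u → InHalf u → InHalf v
  half-path (xy _) (yx {z} e-vz) (xy _) z≢u refl with cover z
  ... | inj₁ refl = ⊥-elim (z≢u refl)
  ... | inj₂ refl = p-wins e-vz
  half-path (yx {w} e-uw) (xy {v} e-vz) (yx e-zw) _ u∈half with cover w
  ... | inj₁ refl = ⊥-elim (true≢false u∈half e-uw)
  ... | inj₂ refl with cover v
  ...   | inj₁ v≡p = v≡p
  ...   | inj₂ refl = ⊥-elim (true≢false e-vz e-zw)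

  half-path′ : ∀ {u v z w} → Arc o v w → Arc o u z → Arc o z w → z ≢ v → InHalf u → InHalf v
  half-path′ (xy {w} _) (yx {z} e-uz) (xy _) z≢v u∈half with cover z
  ... | inj₁ refl = ⊥-elim (true≢false u∈half e-uz)
  ... | inj₂ refl with cover w
  ...   | inj₁ w≡p = w≡p
  ...   | inj₂ refl = ⊥-elim (z≢v refl)
  half-path′ (yx {w} e-vw) (xy e-uz) (yx e-zw) _ refl with cover w
  ... | inj₁ refl = ⊥-elim (true≢false e-uz e-zw)
  ... | inj₂ refl = p-wins e-vw

  adj-preserves-half : ∀ {u v} → C12Adj o u v → InHalf u → InHalf v
  adj-preserves-half (_ , _ , _ , _ , inj₁ (uw , inj₁ vw))               = half-commonPrey uw vw
  adj-preserves-half (_ , _ , _ , _ , inj₁ (uw , inj₂ (_ , z≢u , vz , zw))) = half-path uw vz zw z≢u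
  adj-preserves-half (_ , _ , _ , _ , inj₂ (vw , inj₁ uw))               = half-commonPrey uw vw
  adj-preserves-half (_ , _ , _ , _ , inj₂ (vw , inj₂ (_ , z≢v , uz , zw))) = half-path′ vw uz zw z≢v

  conn-preserves-half : ∀ {u v} → Conn u v → InHalf u → InHalf v
  conn-preserves-half ε         u∈half = u∈half
  conn-preserves-half (adj ◅ c) u∈half = conn-preserves-half c (adj-preserves-half adj u∈half)

  p≁q : ¬ Conn (inj₁ p) (inj₁ q)
  p≁q c = p≢q (sym (conn-preserves-half c refl))

  -- Witnessed by the path p → y′ → q and the arc y → q, for an out-neighbour y′ ≠ y of p.
  adj-p-out : ∀ {y} → o p y ≡ true → C12Adj o (inj₁ p) (inj₂ y)
  adj-p-out {y} e with a ≟ᶠ y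
  ... | yes refl = adj-path (xy e-b) (yx (q-loses e-b)) (yx (q-loses e))
                            λ y≡b → a≢b (inj₂-injective y≡b)
  ... | no a≢y   = adj-path (xy e-a) (yx (q-loses e-a)) (yx (q-loses e))
                            λ y≡a → a≢y (sym (inj₂-injective y≡a))

  half-complete : ∀ {u v} → InHalf u → InHalf v → u ≢ v → C12Adj o u v
  half-complete {inj₁ _} {inj₁ _} refl refl u≢v = ⊥-elim (u≢v refl)
  half-complete {inj₁ _} {inj₂ _} refl e    _   = adj-p-out e
  half-complete {inj₂ _} {inj₁ _} e    refl _   = adj-sym (adj-p-out e)
  half-complete {inj₂ _} {inj₂ _} e    e′   u≢v =
    adj-commonPrey (yx (q-loses e)) (yx (q-loses e′)) u≢v

  component-p : CompleteComponentAtLeast3 o (inj₁ p)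
  component-p =
    (λ u v cu cv → half-complete (conn-preserves-half cu refl) (conn-preserves-half cv refl)) ,
    (inj₁ p , inj₂ a , inj₂ b , ε , adj-p-out e-a ◅ ε , adj-p-out e-b ◅ ε ,
     (λ ()) , (λ a≡b → a≢b (inj₂-injective a≡b)) , (λ ()))

split⇒twoComponents : ∀ {m n} (o : BipartiteTournament m n) →
                      InTournament.Split o → TwoCompleteComponents o
split⇒twoComponents o
  (p , q , p≢q , cover , disagree , (_ , _ , a≢b , e-a , e-b) , (_ , _ , c≢d , e-c , e-d)) =
  inj₁ p , inj₁ q , P.p≁q , covering , P.component-p , Q.component-p
  where
  module P = Halves o p≢q cover disagree a≢b e-a e-b
  module Q = Halves o (≢-sym p≢q) (swap ∘ cover) (λ y → ≢-sym (disagree y)) c≢d e-c e-d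
  covering : ∀ v → Connected o (inj₁ p) v ⊎ Connected o (inj₁ q) v
  covering (inj₁ x) with cover x
  ... | inj₁ refl = inj₁ ε
  ... | inj₂ refl = inj₂ ε
  covering (inj₂ y) with o p y in e
  ... | true  = inj₁ (P.adj-p-out e ◅ ε)
  ... | false = inj₂ (Q.adj-p-out (Q.p-wins e) ◅ ε)

transpose : ∀ {m n} → BipartiteTournament m n → BipartiteTournament n m
transpose o y x = not (o x y)

swap-injective : ∀ {a b} {A : Set a} {B : Set b} {u v : A ⊎ B} → swap u ≡ swap v → u ≡ v
swap-injective {u = u} {v} e =
  trans (sym (swap-involutive u)) (trans (cong swap e) (swap-involutive v))

adj-embed : ∀ {m n m′ n′} {o : BipartiteTournament m n} {o′ : BipartiteTournament m′ n′}
  (f : Vertex m n → Vertex m′ n′) → (∀ {u v} → f u ≡ f v → u ≡ v) →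
  (∀ {u v} → Arc o u v → Arc o′ (f u) (f v)) → ∀ {u v} → C12Adj o u v → C12Adj o′ (f u) (f v)
adj-embed f f-inj arc (u≢v , w , w≢u , w≢v , witness) =
  ≢f u≢v , f w , ≢f w≢u , ≢f w≢v ,
  Sum.map (Product.map arc dist≤2) (Product.map arc dist≤2) witness
  where
  ≢f : ∀ {x y} → x ≢ y → f x ≢ f y
  ≢f x≢y fx≡fy = x≢y (f-inj fx≡fy)
  dist≤2 : ∀ {r a b} → Dist≤2 _ r a b → Dist≤2 _ (f r) (f a) (f b)
  dist≤2 (inj₁ ab)                 = inj₁ (arc ab)
  dist≤2 (inj₂ (z , z≢r , az , zb)) = inj₂ (f z , ≢f z≢r , arc az , arc zb)

module Transpose {m n : ℕ} (o : BipartiteTournament m n) where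

  arc-transpose : ∀ {u v} → Arc o u v → Arc (transpose o) (swap u) (swap v)
  arc-transpose (xy e) = yx (cong not e)
  arc-transpose (yx e) = xy (cong not e)

  arc-untranspose : ∀ {u v} → Arc (transpose o) u v → Arc o (swap u) (swap v)
  arc-untranspose (xy e) = yx (not-injective e)
  arc-untranspose (yx e) = xy (not-injective e)

  conn-transpose : ∀ {u v} → Connected o u v → Connected (transpose o) (swap u) (swap v)
  conn-transpose = gmap swap (adj-embed swap swap-injective arc-transpose)

  conn-untranspose : ∀ {u v} → Connected (transpose o) u v → Connected o (swap u) (swap v)
  conn-untranspose = gmap swap (adj-embed swap swap-injective arc-untranspose)

  conn-transposeˡ : ∀ {a v} → Connected o (swap a) v → Connected (transpose o) a (swap v)
  conn-transposeˡ {a} =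
    subst (λ t → Connected (transpose o) t _) (swap-involutive a) ∘ conn-transpose

  conn-untransposeʳ : ∀ {a v} → Connected (transpose o) a (swap v) → Connected o (swap a) v
  conn-untransposeʳ {v = v} = subst (Connected o _) (swap-involutive v) ∘ conn-untranspose

  commonPrey-transpose : ∀ {w a b} → InTournament.CommonPrey o w a b →
                         InTournament.CommonPrey (transpose o) (swap w) (swap a) (swap b)
  commonPrey-transpose (aw , bw , a≢b) =
    arc-transpose aw , arc-transpose bw , λ e → a≢b (swap-injective e)

  component-untranspose : ∀ {a} → CompleteComponentAtLeast3 (transpose o) a →
                          CompleteComponentAtLeast3 o (swap a)
  component-untranspose {a} (complete , (x , y , z , ax , ay , az , x≢y , y≢z , x≢z)) =
    (λ u v au av u≢v → adj-untranspose
       (complete (swap u) (swap v) (conn-transposeˡ au) (conn-transposeˡ av) (≢-swap u≢v))) ,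
    (swap x , swap y , swap z , conn-untranspose ax , conn-untranspose ay , conn-untranspose az ,
     ≢-swap x≢y , ≢-swap y≢z , ≢-swap x≢z)
    where
    ≢-swap : ∀ {a b} {A : Set a} {B : Set b} {u v : A ⊎ B} → u ≢ v → swap u ≢ swap v
    ≢-swap u≢v e = u≢v (swap-injective e)
    adj-untranspose : ∀ {u v} → C12Adj (transpose o) (swap u) (swap v) → C12Adj o u v
    adj-untranspose {u} {v} = subst₂ (C12Adj o) (swap-involutive u) (swap-involutive v) ∘
                              adj-embed swap swap-injective arc-untranspose

  twoComponents-untranspose : TwoCompleteComponents (transpose o) → TwoCompleteComponents o
  twoComponents-untranspose (a , b , a≁b , covering , component-a , component-b) =
    swap a , swap b ,
    (λ c → a≁b (subst (Connected (transpose o) a) (swap-involutive b) (conn-transposeˡ c))) ,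
    (λ v → Sum.map conn-untransposeʳ conn-untransposeʳ (covering (swap v))) ,
    component-untranspose component-a , component-untranspose component-b

module _ {m n : ℕ} (o : BipartiteTournament m n) where
  open InTournament o
  open Transpose o

  predators-conn : ¬ Split → ¬ InTournament.Split (transpose o) →
                   ∀ {w a b w′ a′ b′} → CommonPrey w a b → CommonPrey w′ a′ b′ → Conn a a′
  predators-conn ¬split₁ _ {inj₁ _} {w′ = inj₁ _} g g′ = samePart-conn ¬split₁ g g′
  predators-conn _ ¬split₂ {inj₂ _} {a = a} {w′ = inj₂ _} g g′ =
    subst (λ t → Conn t _) (swap-involutive a)
      (conn-untransposeʳ (InTournament.samePart-conn (transpose o) ¬split₂
        (commonPrey-transpose g) (commonPrey-transpose g′)))
  predators-conn _ _ {inj₁ x} {w′ = inj₂ y} g g′ with tournament x y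
  ... | inj₁ ww′ = adjacentPrey-conn ww′ g g′
  ... | inj₂ w′w = conn-sym (adjacentPrey-conn w′w g′ g)
  predators-conn _ _ {inj₂ y} {w′ = inj₁ x} g g′ with tournament x y
  ... | inj₁ w′w = conn-sym (adjacentPrey-conn w′w g′ g)
  ... | inj₂ ww′ = adjacentPrey-conn ww′ g g′

  atMostOneNonTrivial : ¬ Split → ¬ InTournament.Split (transpose o) → AtMostOneNonTrivial o
  atMostOneNonTrivial ¬split₁ ¬split₂ u v u-nontrivial v-nontrivial
    with nonTrivial⇒commonPrey u-nontrivial | nonTrivial⇒commonPrey v-nontrivial
  ... | _ , _ , _ , g , u-reaches | _ , _ , _ , g′ , v-reaches =
    reaches-conn-predator g u-reaches ◅◅ predators-conn ¬split₁ ¬split₂ g g′ ◅◅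
    conn-sym (reaches-conn-predator g′ v-reaches)

theorem2p8 : (m n : ℕ) → m ≥ 1 → n ≥ 1 → (o : BipartiteTournament m n) →
    AtMostOneNonTrivial o ⊎ TwoCompleteComponents o
theorem2p8 m n _ _ o with InTournament.split? o | InTournament.split? (transpose o)
... | yes split₁ | _          = inj₂ (split⇒twoComponents o split₁)
... | no _       | yes split₂ =
  inj₂ (Transpose.twoComponents-untranspose o (split⇒twoComponents (transpose o) split₂))
... | no ¬split₁ | no ¬split₂ = inj₁ (atMostOneNonTrivial o ¬split₁ ¬split₂)
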